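{- Let $N=n+d$. The complex $T'_{d,n}$ (equivalently $T_{d,n}$) is shellable; more precisely, the restriction to the facets of $T'_{d,n}$ of the shelling order on trivalent trees in $\mathcal T_N$ defined below is a shelling order of $T'_{d,n}$.
   Context: Labels $1,\dots,n\in[N]$ are marked and $n+1,\dots,n+d$ unmarked. A split $A|B$ of $[N]$ (partition into two nonempty parts) is bicolored if both parts have at least two elements and each part contains a marked and an unmarked label. Splits $A|A'$, $B|B'$ are compatible if one of $A\cap B,A\cap B',A'\cap B,A'\cap B'$ is empty. $T'_{d,n}$ (the space of $n$ tropically collinear points in $\mathbb{TP}^{d-1}=\mathbb R^d/\mathbb R(1,\dots,1)$ modulo simultaneous translation) is given the simplicial structure of the simplicial complex whose vertices are bicolored splits and whose faces are sets of pairwise compatible bicolored splits; its facets are the trivalent trees with leaf set $[N]$ all of whose internal edges induce bicolored splits (a tree is identified with the set of splits induced by its internal edges). Order on subsets of $[N]$: $A<B$ iff $\max\big((A\setminus B)\cup(B\setminus A)\big)\in B$. Order on trivalent trees: root a trivalent tree at leaf $1$; then each internal vertex $V$ has two child subtrees. For two rooted binary trees $T,T'$ with the same leaf set $L$ below the root vertex, let $M_0|M_1$ and $M_0'|M_1'$ be the partitions of $L$ into the leaf sets of the two children, labelled so that $\max L\in M_1$ and $\max L\in M_1'$, and let $T_0,T_1$ (resp. $T_0',T_1'$) be the corresponding subtrees. Then $T'<T$ iff $M_1'<M_1$, or $M_1'=M_1$ and $T_1'<T_1$, or $M_1'=M_1$, $T_1'=T_1$ and $T_0'<T_0$ (recursively;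 trees with a single leaf are equal). This applies with $L=[N]\setminus\{1\}$ to trivalent trees on $[N]$. A pure simplicial complex is shellable if its facets admit an order (a shelling) such that for any facets $C'<C$ there exist a facet $C''<C$ and a vertex $x\in C$ with $x\notin C'$ and $C\setminus\{x\}\subset C''$. -}

module Defs where

open import Data.Nat using (ℕ; _<_; _≤_; _⊔_)
open import Data.Fin using (Fin; toℕ)
open import Data.Fin.Subset using (Subset; _∈_; _∉_; ⁅_⁆; _∪_; _∩_; ∁; ∣_∣; Empty)
open import Data.List using (List; []; _∷_; _++_)
open import Data.List.Relation.Unary.All using (All)
open import Data.List.Relation.Unary.Unique.Propositional using (Unique)
import Data.List.Membership.Propositional as LM
open import Data.Product using (Σ; ∃; _×_; _,_)
open import Data.Sum using (_⊎_)
open import Data.Empty using (⊥)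
open import Data.Unit using (⊤)
open import Relation.Binary.PropositionalEquality using (_≡_; _≢_)

-- Labels 1,…,N are encoded as Fin N: label i ↦ index i-1 (order preserving).
-- Label 1 is the index with toℕ ≡ 0; marked labels 1..n are the indices with
-- toℕ < n, unmarked labels n+1..n+d those with n ≤ toℕ.

module _ {N : ℕ} where

  -- A split A|A' of [N] is given by one part A; the other is its complement.
  -- Compatibility of A|A' and B|B'.
  Compatible : Subset N → Subset N → Set
  Compatible A B =
    Empty (A ∩ B) ⊎ Empty (A ∩ ∁ B) ⊎ Empty (∁ A ∩ B) ⊎ Empty (∁ A ∩ ∁ B)

  HasMarked : ℕ → Subset N → Set
  HasMarked n A = Σ (Fin N) λ i → i ∈ A × toℕ i < n

  HasUnmarked : ℕ → Subset N → Set
  HasUnmarked n A = Σ (Fin N) λ i → i ∈ A × n ≤ toℕ i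

  Bicolored : ℕ → Subset N → Set
  Bicolored n A =
    2 ≤ ∣ A ∣ × 2 ≤ ∣ ∁ A ∣ ×
    HasMarked n A × HasUnmarked n A × HasMarked n (∁ A) × HasUnmarked n (∁ A)

  -- Order on subsets: A < B iff max of the symmetric difference lies in B
  -- (written out: some k ∈ B∖A such that A and B agree above k).
  _<S_ : Subset N → Subset N → Set
  A <S B = Σ (Fin N) λ k → k ∈ B × k ∉ A ×
    ((j : Fin N) → toℕ k < toℕ j → (j ∈ A → j ∈ B) × (j ∈ B → j ∈ A))

  -- A trivalent tree on [N]
  -- is represented by the rooted binary tree obtained by rooting at leaf 1 and
  -- deleting leaf 1 (its leaves are then [N]∖{1}).
  data BT : Set where
    leaf : Fin N → BT
    node : BT → BT → BT

  leaves : BT → List (Fin N)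
  leaves (leaf i) = i ∷ []
  leaves (node a b) = leaves a ++ leaves b

  leafSet : BT → Subset N
  leafSet (leaf i) = ⁅ i ⁆
  leafSet (node a b) = leafSet a ∪ leafSet b

  maxLeaf : BT → ℕ
  maxLeaf (leaf i) = toℕ i
  maxLeaf (node a b) = maxLeaf a ⊔ maxLeaf b

  -- Canonical representative of an unordered rooted binary tree: at every
  -- internal vertex the child subtree containing the maximal leaf is the
  -- second one ("M₁"), the other one is the first ("M₀").
  Canonical : BT → Set
  Canonical (leaf _) = ⊤
  Canonical (node a b) = Canonical a × Canonical b × maxLeaf a < maxLeaf b

  IsTreeOnN : BT → Set
  IsTreeOnN t = Unique (leaves t) ×
    ((j : Fin N) → (j LM.∈ leaves t → toℕ j ≢ 0) × (toℕ j ≢ 0 → j LM.∈ leaves t))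

  -- The edge above a non-root internal
  -- vertex v induces the split S_v | [N]∖S_v, S_v = leaves below v.
  -- The edge above the root vertex goes to leaf 1 and is a leaf edge.
  belowSplits : BT → List (Subset N)
  belowSplits (leaf _) = []
  belowSplits (node a b) = leafSet (node a b) ∷ (belowSplits a ++ belowSplits b)

  splits : BT → List (Subset N)
  splits (leaf _) = []
  splits (node a b) = belowSplits a ++ belowSplits b

  IsFacet : ℕ → BT → Set
  IsFacet n t = Canonical t × IsTreeOnN t × All (Bicolored n) (splits t)

  _<T_ : BT → BT → Set
  leaf _ <T _ = ⊥
  node _ _ <T leaf _ = ⊥
  node a₀ a₁ <T node b₀ b₁ =
    (leafSet a₁ <S leafSet b₁) ⊎
    (leafSet a₁ ≡ leafSet b₁ × ((a₁ <T b₁) ⊎ (a₁ ≡ b₁ × (a₀ <T b₀))))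

  -- Shelling property of an order on a set of facets (facets are sets of
  -- vertices, here given as lists of splits via `splits`).
  IsShellingOrder : (BT → Set) → (BT → BT → Set) → Set
  IsShellingOrder F _≺_ =
    (C C′ : BT) → F C → F C′ → C′ ≺ C →
    Σ BT λ C″ → F C″ × C″ ≺ C ×
      Σ (Subset N) λ x → x LM.∈ splits C × ¬∈ x (splits C′) ×
        ((y : Subset N) → y LM.∈ splits C → y ≢ x → y LM.∈ splits C″)
    where
    ¬∈ : Subset N → List (Subset N) → Set
    ¬∈ x l = x LM.∈ l → ⊥

  IsStrictTotalOn : (BT → Set) → (BT → BT → Set) → Set
  IsStrictTotalOn F _≺_ =
    ((C : BT) → F C → C ≺ C → ⊥) ×
    ((C₁ C₂ C₃ : BT) → F C₁ → F C₂ → F C₃ → C₁ ≺ C₂ → C₂ ≺ C₃ → C₁ ≺ C₃) ×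
    ((C₁ C₂ : BT) → F C₁ → F C₂ → C₁ ≡ C₂ ⊎ C₁ ≺ C₂ ⊎ C₂ ≺ C₁)

module Submission where

-- In its one delicate case every move along the right spine of C is blocked
-- by a decreasing chain of same-coloured leaves; then the left subtree of C′
-- would be monochromatic with two leaves, contradicting bicolouredness.

open import Data.Nat using (ℕ; _+_; _<_; _≤_; _⊔_; z≤n; s≤s; _<ᵇ_)
open import Data.Nat.Properties
  using (≤-refl; ≤-reflexive; ≤-trans; <-trans; ≤-<-trans; <⇒≤; <⇒≱; ≮⇒≥; ≤-antisym; ≤-pred;
         <-irrefl; <-cmp; ≤∧≢⇒<; <ᵇ⇒<; <⇒<ᵇ; m≤m⊔n; m≤n⊔m; ⊔-sel; ⊔-lub; ⊔-comm; m≤n⇒m⊔n≡n)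
open import Data.Fin using (Fin; toℕ; zero; suc)
open import Data.Fin.Properties using (toℕ-injective) renaming (_≟_ to _≟ᶠ_)
open import Data.Fin.Subset
  using (Subset; _∈_; _∉_; ⁅_⁆; _∪_; ∁; ∣_∣; _⊆_; inside; outside; _-_)
open import Data.Fin.Subset.Properties
  using (x∈⁅x⁆; x∈⁅y⁆⇒x≡y; x∈p∪q⁺; x∈p∪q⁻; x∈∁p⇒x∉p; x∉p⇒x∈∁p; ⊆-antisym;
         ∪-assoc; ∪-comm; drop-there; x∈p⇒∣p-x∣<∣p∣; x∈p∧x≢y⇒x∈p-y; ∣⁅x⁆∣≡1;
         p⊆q⇒∣p∣≤∣q∣)
open import Data.Vec using ([]; _∷_; here; there)
open import Data.Bool using (Bool; true; false; T)
open import Data.List using (List; []; _∷_; _++_)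
import Data.List.Membership.Propositional as List
open import Data.List.Membership.Propositional.Properties using (∈-++⁺ˡ; ∈-++⁺ʳ; ∈-++⁻)
open import Data.List.Relation.Unary.Any using (here; there)
open import Data.List.Relation.Unary.All as All using ([])
import Data.List.Relation.Unary.All.Properties as All
open import Data.List.Relation.Unary.AllPairs using ([]; _∷_)
open import Data.List.Relation.Unary.Unique.Propositional using (Unique)
import Data.List.Relation.Unary.Unique.Propositional.Properties as Unique
open import Data.Product using (Σ; _×_; _,_; proj₁; proj₂)
open import Data.Sum using (_⊎_; inj₁; inj₂; [_,_]′)
open import Data.Empty using (⊥; ⊥-elim)
open import Data.Unit using (⊤; tt)
open import Relation.Nullary using (yes; no)
open import Relation.Binary.Definitions using (tri<; tri≈; tri>)
open import Relation.Binary.PropositionalEquality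
  using (_≡_; _≢_; refl; sym; trans; cong; subst)
open import Defs

module _ {N : ℕ} where

  ∈∪ˡ : ∀ {x : Fin N} {p q} → x ∈ p → x ∈ p ∪ q
  ∈∪ˡ h = x∈p∪q⁺ (inj₁ h)

  ∈∪ʳ : ∀ {x : Fin N} {p q} → x ∈ q → x ∈ p ∪ q
  ∈∪ʳ h = x∈p∪q⁺ (inj₂ h)

  ∈⁅⁆⇒≡ : ∀ {x y : Fin N} → x ∈ ⁅ y ⁆ → x ≡ y
  ∈⁅⁆⇒≡ {y = y} = x∈⁅y⁆⇒x≡y y

  Disjoint : Subset N → Subset N → Set
  Disjoint A B = ∀ {j} → j ∈ A → j ∈ B → ⊥

  witness-⊆ : ∀ {A B : Subset N} {P : Fin N → Set} → A ⊆ B →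
              Σ (Fin N) (λ i → i ∈ A × P i) → Σ (Fin N) (λ i → i ∈ B × P i)
  witness-⊆ A⊆B (i , i∈A , Pi) = i , A⊆B i∈A , Pi

  two≤card : ∀ (A : Subset N) {i j} → i ∈ A → j ∈ A → i ≢ j → 2 ≤ ∣ A ∣
  two≤card A {i} {j} i∈A j∈A i≢j = ≤-trans (s≤s one≤) (x∈p⇒∣p-x∣<∣p∣ i∈A)
    where
    j∈A-i : j ∈ A - i
    j∈A-i = x∈p∧x≢y⇒x∈p-y j∈A (λ e → i≢j (sym e))
    one≤ : 1 ≤ ∣ A - i ∣
    one≤ = subst (_≤ ∣ A - i ∣) (∣⁅x⁆∣≡1 j)
             (p⊆q⇒∣p∣≤∣q∣ (λ h → subst (_∈ A - i) (sym (∈⁅⁆⇒≡ h)) j∈A-i))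

  disjoint-∪-cancelʳ : ∀ {A₀ A₁ B₀ B₁ : Subset N} → Disjoint A₀ A₁ → Disjoint B₀ B₁ →
                       A₀ ∪ A₁ ≡ B₀ ∪ B₁ → A₁ ≡ B₁ → A₀ ≡ B₀
  disjoint-∪-cancelʳ {A₀} {A₁} {B₀} {B₁} dA dB e e₁ = ⊆-antisym A₀⊆B₀ B₀⊆A₀
    where
    A₀⊆B₀ : A₀ ⊆ B₀
    A₀⊆B₀ {x} h with x∈p∪q⁻ B₀ B₁ (subst (x ∈_) e (∈∪ˡ h))
    ... | inj₁ h′ = h′
    ... | inj₂ h′ = ⊥-elim (dA h (subst (x ∈_) (sym e₁) h′))
    B₀⊆A₀ : B₀ ⊆ A₀
    B₀⊆A₀ {x} h with x∈p∪q⁻ A₀ A₁ (subst (x ∈_) (sym e) (∈∪ˡ h))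
    ... | inj₁ h′ = h′
    ... | inj₂ h′ = ⊥-elim (dB h (subst (x ∈_) e₁ h′))

-- The order on subsets: strict, and total (a subset is a bit vector, and
-- the order compares the vectors from the top index downwards).

<S-irrefl : ∀ {N} {A : Subset N} → A <S A → ⊥
<S-irrefl (_ , k∈A , k∉A , _) = k∉A k∈A

<S-trans : ∀ {N} {A B C : Subset N} → A <S B → B <S C → A <S C
<S-trans {B = B} (k , kB , kA , ag) (l , lC , lB , ag′) with <-cmp (toℕ k) (toℕ l)
... | tri< k<l _ _ = l , lC , (λ lA → lB (proj₁ (ag l k<l) lA)) ,
      λ j l<j → (λ jA → proj₁ (ag′ j l<j) (proj₁ (ag j (<-trans k<l l<j)) jA)) ,
                (λ jC → proj₂ (ag j (<-trans k<l l<j)) (proj₂ (ag′ j l<j) jC))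
... | tri≈ _ k≡l _ = ⊥-elim (lB (subst (_∈ B) (toℕ-injective k≡l) kB))
... | tri> _ _ l<k = k , proj₁ (ag′ k l<k) kB , kA ,
      λ j k<j → (λ jA → proj₁ (ag′ j (<-trans l<k k<j)) (proj₁ (ag j k<j) jA)) ,
                (λ jC → proj₂ (ag j k<j) (proj₂ (ag′ j (<-trans l<k k<j)) jC))

∷-<S : ∀ {N} {a b} {A B : Subset N} → A <S B → (a ∷ A) <S (b ∷ B)
∷-<S (k , kB , kA , ag) = suc k , there kB , (λ h → kA (drop-there h)) ,
  λ { zero () ; (suc j) k<j → (λ h → there (proj₁ (ag j (≤-pred k<j)) (drop-there h))) ,
                             (λ h → there (proj₂ (ag j (≤-pred k<j)) (drop-there h))) }

outside<inside : ∀ {N} {A : Subset N} → (outside ∷ A) <S (inside ∷ A)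
outside<inside = zero , here , (λ ()) ,
  λ { zero () ; (suc j) _ → (λ h → there (drop-there h)) , (λ h → there (drop-there h)) }

<S-tri : ∀ {N} (A B : Subset N) → A ≡ B ⊎ A <S B ⊎ B <S A
<S-tri [] [] = inj₁ refl
<S-tri (a ∷ A) (b ∷ B) with <S-tri A B
... | inj₂ (inj₁ A<B) = inj₂ (inj₁ (∷-<S A<B))
... | inj₂ (inj₂ B<A) = inj₂ (inj₂ (∷-<S B<A))
<S-tri (inside ∷ A) (inside ∷ .A) | inj₁ refl = inj₁ refl
<S-tri (outside ∷ A) (outside ∷ .A) | inj₁ refl = inj₁ refl
<S-tri (outside ∷ A) (inside ∷ .A) | inj₁ refl = inj₂ (inj₁ outside<inside)
<S-tri (inside ∷ A) (outside ∷ .A) | inj₁ refl = inj₂ (inj₂ outside<inside)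

module _ {N : ℕ} where

  leaf≤maxLeaf : ∀ (t : BT {N}) {j} → j ∈ leafSet t → toℕ j ≤ maxLeaf t
  leaf≤maxLeaf (leaf i) h rewrite ∈⁅⁆⇒≡ h = ≤-refl
  leaf≤maxLeaf (node a b) h with x∈p∪q⁻ (leafSet a) (leafSet b) h
  ... | inj₁ h′ = ≤-trans (leaf≤maxLeaf a h′) (m≤m⊔n _ _)
  ... | inj₂ h′ = ≤-trans (leaf≤maxLeaf b h′) (m≤n⊔m _ _)

  maxLeaf-attained : ∀ (t : BT {N}) → Σ (Fin N) λ j → j ∈ leafSet t × toℕ j ≡ maxLeaf t
  maxLeaf-attained (leaf i) = i , x∈⁅x⁆ i , refl
  maxLeaf-attained (node a b) with ⊔-sel (maxLeaf a) (maxLeaf b)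
  ... | inj₁ e = let (j , h , q) = maxLeaf-attained a in j , ∈∪ˡ h , trans q (sym e)
  ... | inj₂ e = let (j , h , q) = maxLeaf-attained b in j , ∈∪ʳ h , trans q (sym e)

  maxLabel : BT {N} → Fin N
  maxLabel t = proj₁ (maxLeaf-attained t)

  maxLabel∈ : ∀ (t : BT {N}) → maxLabel t ∈ leafSet t
  maxLabel∈ t = proj₁ (proj₂ (maxLeaf-attained t))

  maxLabel-toℕ : ∀ (t : BT {N}) → toℕ (maxLabel t) ≡ maxLeaf t
  maxLabel-toℕ t = proj₂ (proj₂ (maxLeaf-attained t))

  maxLeaf-cong : ∀ (t t′ : BT {N}) → leafSet t ≡ leafSet t′ → maxLeaf t ≡ maxLeaf t′
  maxLeaf-cong t t′ e =
    let (j , h , q) = maxLeaf-attained t ; (j′ , h′ , q′) = maxLeaf-attained t′ in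
    ≤-antisym (subst (_≤ maxLeaf t′) q (leaf≤maxLeaf t′ (subst (j ∈_) e h)))
              (subst (_≤ maxLeaf t) q′ (leaf≤maxLeaf t (subst (j′ ∈_) (sym e) h′)))

  -- A proper tree is canonical and its two children at each vertex have
  -- disjoint leaf sets.  For canonical trees this is equivalent to the leaf
  -- list having no repetitions.
  Proper : BT {N} → Set
  Proper (leaf _) = ⊤
  Proper (node a b) = Proper a × Proper b × maxLeaf a < maxLeaf b × Disjoint (leafSet a) (leafSet b)

  maxLeaf-right : ∀ (a b : BT {N}) → Proper (node a b) → maxLeaf (node a b) ≡ maxLeaf b
  maxLeaf-right a b (_ , _ , a<b , _) = m≤n⇒m⊔n≡n (<⇒≤ a<b)

  ∈leafSet⇒∈leaves : ∀ (t : BT {N}) {j} → j ∈ leafSet t → j List.∈ leaves t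
  ∈leafSet⇒∈leaves (leaf i) h = here (∈⁅⁆⇒≡ h)
  ∈leafSet⇒∈leaves (node a b) h with x∈p∪q⁻ (leafSet a) (leafSet b) h
  ... | inj₁ h′ = ∈-++⁺ˡ (∈leafSet⇒∈leaves a h′)
  ... | inj₂ h′ = ∈-++⁺ʳ (leaves a) (∈leafSet⇒∈leaves b h′)

  ∈leaves⇒∈leafSet : ∀ (t : BT {N}) {j} → j List.∈ leaves t → j ∈ leafSet t
  ∈leaves⇒∈leafSet (leaf i) (here refl) = x∈⁅x⁆ i
  ∈leaves⇒∈leafSet (node a b) h with ∈-++⁻ (leaves a) h
  ... | inj₁ h′ = ∈∪ˡ (∈leaves⇒∈leafSet a h′)
  ... | inj₂ h′ = ∈∪ʳ (∈leaves⇒∈leafSet b h′)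

  proper⇒unique : ∀ (t : BT {N}) → Proper t → Unique (leaves t)
  proper⇒unique (leaf i) _ = [] ∷ []
  proper⇒unique (node a b) (pa , pb , _ , d) =
    Unique.++⁺ (proper⇒unique a pa) (proper⇒unique b pb)
      (λ (h₁ , h₂) → d (∈leaves⇒∈leafSet a h₁) (∈leaves⇒∈leafSet b h₂))

  proper⇒canonical : ∀ (t : BT {N}) → Proper t → Canonical t
  proper⇒canonical (leaf i) _ = tt
  proper⇒canonical (node a b) (pa , pb , lt , _) = proper⇒canonical a pa , proper⇒canonical b pb , lt

  unique-++⁻ : ∀ (xs : List (Fin N)) {ys} → Unique (xs ++ ys) →
               Unique xs × Unique ys × (∀ {j} → j List.∈ xs → j List.∈ ys → ⊥)
  unique-++⁻ [] u = [] , u , λ ()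
  unique-++⁻ (x ∷ xs) (x∉ ∷ u) =
    let (u₁ , u₂ , d) = unique-++⁻ xs u in
    (All.++⁻ˡ xs x∉ ∷ u₁) , u₂ ,
    λ { (here refl) h₂ → All.lookup (All.++⁻ʳ xs x∉) h₂ refl ; (there h₁) h₂ → d h₁ h₂ }

  canonical⇒proper : ∀ (t : BT {N}) → Canonical t → Unique (leaves t) → Proper t
  canonical⇒proper (leaf i) _ _ = tt
  canonical⇒proper (node a b) (ca , cb , lt) u =
    let (u₁ , u₂ , d) = unique-++⁻ (leaves a) u in
    canonical⇒proper a ca u₁ , canonical⇒proper b cb u₂ , lt ,
    λ h₁ h₂ → d (∈leafSet⇒∈leaves a h₁) (∈leafSet⇒∈leaves b h₂)

  <T-irrefl : ∀ (t : BT {N}) → t <T t → ⊥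
  <T-irrefl (leaf _) ()
  <T-irrefl (node a b) (inj₁ s) = <S-irrefl s
  <T-irrefl (node a b) (inj₂ (_ , inj₁ b<b)) = <T-irrefl b b<b
  <T-irrefl (node a b) (inj₂ (_ , inj₂ (_ , a<a))) = <T-irrefl a a<a

  <T-trans : ∀ (t₁ t₂ t₃ : BT {N}) → t₁ <T t₂ → t₂ <T t₃ → t₁ <T t₃
  <T-trans (leaf _) _ _ () _
  <T-trans (node _ _) (leaf _) _ () _
  <T-trans (node _ _) (node _ _) (leaf _) _ ()
  <T-trans (node _ _) (node _ _) (node _ _) (inj₁ s) (inj₁ s′) = inj₁ (<S-trans s s′)
  <T-trans (node _ _) (node _ _) (node _ _) (inj₁ s) (inj₂ (e , _)) = inj₁ (subst (_ <S_) e s)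
  <T-trans (node _ _) (node _ _) (node _ _) (inj₂ (e , _)) (inj₁ s) = inj₁ (subst (_<S _) (sym e) s)
  <T-trans (node _ a₁) (node _ b₁) (node _ c₁) (inj₂ (e , inj₁ h)) (inj₂ (e′ , inj₁ h′)) =
    inj₂ (trans e e′ , inj₁ (<T-trans a₁ b₁ c₁ h h′))
  <T-trans (node _ _) (node _ _) (node _ _) (inj₂ (e , inj₁ h)) (inj₂ (e′ , inj₂ (refl , _))) =
    inj₂ (trans e e′ , inj₁ h)
  <T-trans (node _ _) (node _ _) (node _ _) (inj₂ (e , inj₂ (refl , _))) (inj₂ (e′ , inj₁ h′)) =
    inj₂ (trans e e′ , inj₁ h′)
  <T-trans (node a₀ _) (node b₀ _) (node c₀ _) (inj₂ (e , inj₂ (refl , h))) (inj₂ (e′ , inj₂ (refl , h′))) =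
    inj₂ (trans e e′ , inj₂ (refl , <T-trans a₀ b₀ c₀ h h′))

  node-not-singleton : ∀ (a b : BT {N}) (i : Fin N) → Disjoint (leafSet a) (leafSet b) →
                       leafSet (node a b) ≢ ⁅ i ⁆
  node-not-singleton a b i d e =
    let (j , h , _) = maxLeaf-attained a ; (j′ , h′ , _) = maxLeaf-attained b
        j≡i = ∈⁅⁆⇒≡ (subst (j ∈_) e (∈∪ˡ h)) ; j′≡i = ∈⁅⁆⇒≡ (subst (j′ ∈_) e (∈∪ʳ h′))
    in d h (subst (_∈ leafSet b) (trans j′≡i (sym j≡i)) h′)

  <T-tri : ∀ (t t′ : BT {N}) → Proper t → Proper t′ → leafSet t ≡ leafSet t′ →
           t ≡ t′ ⊎ t <T t′ ⊎ t′ <T t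
  <T-tri (leaf i) (leaf j) _ _ e = inj₁ (cong leaf (∈⁅⁆⇒≡ (subst (i ∈_) e (x∈⁅x⁆ i))))
  <T-tri (leaf i) (node a b) _ (_ , _ , _ , d) e = ⊥-elim (node-not-singleton a b i d (sym e))
  <T-tri (node a b) (leaf i) (_ , _ , _ , d) _ e = ⊥-elim (node-not-singleton a b i d e)
  <T-tri (node a₀ a₁) (node b₀ b₁) (pa₀ , pa₁ , _ , da) (pb₀ , pb₁ , _ , db) e
    with <S-tri (leafSet a₁) (leafSet b₁)
  ... | inj₂ (inj₁ s) = inj₂ (inj₁ (inj₁ s))
  ... | inj₂ (inj₂ s) = inj₂ (inj₂ (inj₁ s))
  ... | inj₁ e₁ with <T-tri a₁ b₁ pa₁ pb₁ e₁
  ...   | inj₂ (inj₁ h) = inj₂ (inj₁ (inj₂ (e₁ , inj₁ h)))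
  ...   | inj₂ (inj₂ h) = inj₂ (inj₂ (inj₂ (sym e₁ , inj₁ h)))
  ...   | inj₁ refl with <T-tri a₀ b₀ pa₀ pb₀ (disjoint-∪-cancelʳ da db e e₁)
  ...     | inj₁ refl = inj₁ refl
  ...     | inj₂ (inj₁ h) = inj₂ (inj₁ (inj₂ (e₁ , inj₂ (refl , h))))
  ...     | inj₂ (inj₂ h) = inj₂ (inj₂ (inj₂ (sym e₁ , inj₂ (refl , h))))

  belowSplits-cases : ∀ (t : BT {N}) {y} → y List.∈ belowSplits t → y ≡ leafSet t ⊎ y List.∈ splits t
  belowSplits-cases (leaf _) ()
  belowSplits-cases (node _ _) (here e) = inj₁ e
  belowSplits-cases (node _ _) (there m) = inj₂ m

  belowSplit⊆leafSet : ∀ (t : BT {N}) {y} → y List.∈ belowSplits t → y ⊆ leafSet t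
  belowSplit⊆leafSet (leaf _) ()
  belowSplit⊆leafSet (node a b) (here refl) h = h
  belowSplit⊆leafSet (node a b) (there m) h with ∈-++⁻ (belowSplits a) m
  ... | inj₁ m′ = ∈∪ˡ (belowSplit⊆leafSet a m′ h)
  ... | inj₂ m′ = ∈∪ʳ (belowSplit⊆leafSet b m′ h)

  belowSplit-inhabited : ∀ (t : BT {N}) {y} → y List.∈ belowSplits t → Σ (Fin N) (_∈ y)
  belowSplit-inhabited (leaf _) ()
  belowSplit-inhabited (node a b) (here refl) = let (j , h , _) = maxLeaf-attained (node a b) in j , h
  belowSplit-inhabited (node a b) (there m) with ∈-++⁻ (belowSplits a) m
  ... | inj₁ m′ = belowSplit-inhabited a m′
  ... | inj₂ m′ = belowSplit-inhabited b m′

  split⊆child : ∀ (a b : BT {N}) {y} → y List.∈ splits (node a b) → y ⊆ leafSet a ⊎ y ⊆ leafSet b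
  split⊆child a b m with ∈-++⁻ (belowSplits a) m
  ... | inj₁ m′ = inj₁ (belowSplit⊆leafSet a m′)
  ... | inj₂ m′ = inj₂ (belowSplit⊆leafSet b m′)

  split⊆leafSet : ∀ (t : BT {N}) {y} → y List.∈ splits t → y ⊆ leafSet t
  split⊆leafSet (leaf _) ()
  split⊆leafSet (node a b) m with split⊆child a b m
  ... | inj₁ s = λ h → ∈∪ˡ (s h)
  ... | inj₂ s = λ h → ∈∪ʳ (s h)

  split-inhabited : ∀ (t : BT {N}) {y} → y List.∈ splits t → Σ (Fin N) (_∈ y)
  split-inhabited (leaf _) ()
  split-inhabited (node a b) m with ∈-++⁻ (belowSplits a) m
  ... | inj₁ m′ = belowSplit-inhabited a m′
  ... | inj₂ m′ = belowSplit-inhabited b m′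

  split≢leafSet : ∀ (t : BT {N}) → Proper t → ∀ {y} → y List.∈ splits t → y ≢ leafSet t
  split≢leafSet (leaf _) _ ()
  split≢leafSet (node a b) (_ , _ , _ , d) m refl with split⊆child a b m
  ... | inj₁ s = let (j , h , _) = maxLeaf-attained b in d (s (∈∪ʳ h)) h
  ... | inj₂ s = let (j , h , _) = maxLeaf-attained a in d h (s (∈∪ˡ h))

  split-of-right-child : ∀ (a b₀ b₁ : BT {N}) → Proper a → Disjoint (leafSet b₀) (leafSet b₁) →
    leafSet b₁ ≡ leafSet a → ∀ {x} → x List.∈ splits a → x List.∈ splits (node b₀ b₁) →
    x List.∈ splits b₁
  split-of-right-child a b₀ b₁ pa db e {x} x∈a m with split-inhabited a x∈a | ∈-++⁻ (belowSplits b₀) m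
  ... | (j , j∈x) | inj₁ m′ =
    ⊥-elim (db (belowSplit⊆leafSet b₀ m′ j∈x) (subst (j ∈_) (sym e) (split⊆leafSet a x∈a j∈x)))
  ... | _ | inj₂ m′ with belowSplits-cases b₁ m′
  ...   | inj₁ x≡B₁ = ⊥-elim (split≢leafSet a pa x∈a (trans x≡B₁ e))
  ...   | inj₂ m″ = m″

  split-of-left-child : ∀ (a b₀ b₁ : BT {N}) → Proper a → Disjoint (leafSet a) (leafSet b₁) →
    leafSet b₀ ≡ leafSet a → ∀ {x} → x List.∈ splits a → x List.∈ splits (node b₀ b₁) →
    x List.∈ splits b₀
  split-of-left-child a b₀ b₁ pa da e {x} x∈a m with split-inhabited a x∈a | ∈-++⁻ (belowSplits b₀) m
  ... | (j , j∈x) | inj₂ m′ = ⊥-elim (da (split⊆leafSet a x∈a j∈x) (belowSplit⊆leafSet b₁ m′ j∈x))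
  ... | _ | inj₁ m′ with belowSplits-cases b₀ m′
  ...   | inj₁ x≡B₀ = ⊥-elim (split≢leafSet a pa x∈a (trans x≡B₀ e))
  ...   | inj₂ m″ = m″

  maxLabel∈right : ∀ (a b : BT {N}) → Proper (node a b) → ∀ {j} → toℕ j ≡ maxLeaf (node a b) → j ∈ leafSet b
  maxLabel∈right a b p {j} e =
    let (j′ , h , q) = maxLeaf-attained b in
    subst (_∈ leafSet b) (sym (toℕ-injective (trans e (trans (maxLeaf-right a b p) (sym q))))) h

  split∋max⊆right : ∀ (a b : BT {N}) → Proper (node a b) → ∀ {W j} → W List.∈ splits (node a b) →
                     j ∈ W → toℕ j ≡ maxLeaf (node a b) → W ⊆ leafSet b
  split∋max⊆right a b p@(_ , _ , _ , d) m j∈W e with split⊆child a b m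
  ... | inj₁ s = ⊥-elim (d (s j∈W) (maxLabel∈right a b p e))
  ... | inj₂ s = s

  -- The right child of a proper vertex precedes the vertex itself in the
  -- order on subsets (they differ exactly in the left child, whose labels
  -- are all below the maximum of the left child).
  right<S-node : ∀ (c₀ c₁ : BT {N}) → Proper (node c₀ c₁) → leafSet c₁ <S leafSet (node c₀ c₁)
  right<S-node c₀ c₁ (_ , _ , _ , d) with maxLeaf-attained c₀
  ... | m₀ , m₀∈C₀ , m₀≡ =
    m₀ , ∈∪ˡ m₀∈C₀ , d m₀∈C₀ ,
    λ j m₀<j → ∈∪ʳ , λ h → above j m₀<j (x∈p∪q⁻ (leafSet c₀) (leafSet c₁) h)
    where
    above : ∀ j → toℕ m₀ < toℕ j → j ∈ leafSet c₀ ⊎ j ∈ leafSet c₁ → j ∈ leafSet c₁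
    above j m₀<j (inj₁ h) = ⊥-elim (<⇒≱ m₀<j (subst (toℕ j ≤_) (sym m₀≡) (leaf≤maxLeaf c₀ h)))
    above j m₀<j (inj₂ h) = h

  splits-right⊆ : ∀ (a b : BT {N}) {y} → y List.∈ splits b → y List.∈ splits (node a b)
  splits-right⊆ a (leaf _) ()
  splits-right⊆ a (node _ _) m = ∈-++⁺ʳ (belowSplits a) (there m)

  splits-left⊆ : ∀ (a b : BT {N}) {y} → y List.∈ splits a → y List.∈ splits (node a b)
  splits-left⊆ (leaf _) b ()
  splits-left⊆ (node _ _) b m = ∈-++⁺ˡ (there m)

  record Join (s c : BT {N}) : Set where
    field
      tree : BT {N}
      proper : Proper tree
      leafSet≡ : leafSet tree ≡ leafSet s ∪ leafSet c
      maxLeaf≡ : maxLeaf tree ≡ maxLeaf s ⊔ maxLeaf c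
      splits⁻ : ∀ {y} → y List.∈ splits tree → y List.∈ belowSplits s ++ belowSplits c
      splits⁺ : ∀ {y} → y List.∈ belowSplits s ++ belowSplits c → y List.∈ splits tree

  join : ∀ (s c : BT {N}) → Proper s → Proper c → Disjoint (leafSet s) (leafSet c) → Join s c
  join s c ps pc d with <-cmp (maxLeaf s) (maxLeaf c)
  ... | tri< s<c _ _ = record
    { tree = node s c ; proper = ps , pc , s<c , d ; leafSet≡ = refl ; maxLeaf≡ = refl
    ; splits⁻ = λ m → m ; splits⁺ = λ m → m }
  ... | tri> _ _ c<s = record
    { tree = node c s ; proper = pc , ps , c<s , (λ h₁ h₂ → d h₂ h₁)
    ; leafSet≡ = ∪-comm (leafSet c) (leafSet s) ; maxLeaf≡ = ⊔-comm (maxLeaf c) (maxLeaf s)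
    ; splits⁻ = ++-swap (belowSplits c) (belowSplits s)
    ; splits⁺ = ++-swap (belowSplits s) (belowSplits c) }
    where
    ++-swap : ∀ (xs ys : List (Subset N)) {y} → y List.∈ xs ++ ys → y List.∈ ys ++ xs
    ++-swap xs ys m with ∈-++⁻ xs m
    ... | inj₁ m′ = ∈-++⁺ʳ ys m′
    ... | inj₂ m′ = ∈-++⁺ˡ m′
  ... | tri≈ _ s≡c _ =
    let (js , hs , es) = maxLeaf-attained s ; (jc , hc , ec) = maxLeaf-attained c in
    ⊥-elim (d hs (subst (_∈ leafSet c) (toℕ-injective (trans ec (trans (sym s≡c) (sym es)))) hc))

module Shelling {N : ℕ} (n : ℕ) where

  Marked Unmarked : Fin N → Set
  Marked j = toℕ j < n
  Unmarked j = n ≤ toℕ j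

  colour : Fin N → Bool
  colour j = toℕ j <ᵇ n

  colour-spec : ∀ j → (Marked j × colour j ≡ true) ⊎ (Unmarked j × colour j ≡ false)
  colour-spec j with toℕ j <ᵇ n in eq
  ... | true = inj₁ (<ᵇ⇒< (toℕ j) n (subst T (sym eq) tt) , refl)
  ... | false = inj₂ (≮⇒≥ (λ m → subst T eq (<⇒<ᵇ m)) , refl)

  colour-separates : ∀ {i j} → Marked i → Unmarked j → colour i ≢ colour j
  colour-separates {i} {j} mi uj e with colour-spec i | colour-spec j
  ... | inj₂ (ui , _) | _ = <⇒≱ mi ui
  ... | _ | inj₁ (mj , _) = <⇒≱ mj uj
  ... | inj₁ (_ , ci) | inj₂ (_ , cj) with trans (sym ci) (trans e cj)
  ...   | ()

  sameColour-unmarked : ∀ {i j} → colour i ≡ colour j → Unmarked i → Unmarked j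
  sameColour-unmarked {i} {j} e ui with colour-spec j
  ... | inj₂ (uj , _) = uj
  ... | inj₁ (mj , _) = ⊥-elim (colour-separates mj ui (sym e))

  Bicoloured : Subset N → Set
  Bicoloured = Bicolored {N} n

  marked-in : ∀ {A} → Bicoloured A → HasMarked n A
  marked-in (_ , _ , h , _) = h

  unmarked-in : ∀ {A} → Bicoloured A → HasUnmarked n A
  unmarked-in (_ , _ , _ , h , _) = h

  unmarked-out : ∀ {A} → Bicoloured A → HasUnmarked n (∁ A)
  unmarked-out (_ , _ , _ , _ , _ , h) = h

  Valid : BT {N} → Set
  Valid t = ∀ {y} → y List.∈ splits t → Bicoloured y

  OmitsRoot : BT {N} → Set
  OmitsRoot t = ∀ {j} → j ∈ leafSet t → toℕ j ≢ 0

  -- Label 1 exists as soon as some label does; it lies outside every set of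
  -- leaves, and it is marked as soon as some label is.

  label1 : Fin N → Σ (Fin N) λ r → toℕ r ≡ 0
  label1 zero = zero , refl
  label1 (suc _) = zero , refl

  complement-of-leaves : ∀ (t : BT {N}) {X V : Subset N} {m : Fin N} → OmitsRoot t →
    X ⊆ leafSet t → m ∈ leafSet t → m ∉ X → HasMarked n V →
    2 ≤ ∣ ∁ X ∣ × HasMarked n (∁ X)
  complement-of-leaves t {X} {m = m} omits X⊆t m∈t m∉X (i , _ , i<n) with label1 m
  ... | r , r≡0 =
    two≤card (∁ X) r∉X (x∉p⇒x∈∁p m∉X) r≢m , r , r∉X , subst (_< n) (sym r≡0) (≤-<-trans z≤n i<n)
    where
    r∉X : r ∈ ∁ X
    r∉X = x∉p⇒x∈∁p (λ h → omits (X⊆t h) r≡0)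
    r≢m : r ≢ m
    r≢m e = omits m∈t (subst (λ w → toℕ w ≡ 0) e r≡0)

  valid-right : ∀ (a b : BT {N}) → Valid (node a b) → Valid b
  valid-right a b v m = v (splits-right⊆ a b m)

  valid-left : ∀ (a b : BT {N}) → Valid (node a b) → Valid a
  valid-left a b v m = v (splits-left⊆ a b m)

  record Predecessor (t : BT {N}) (x : Subset N) : Set where
    constructor predecessor
    field
      tree : BT {N}
      proper : Proper tree
      leafSet≡ : leafSet tree ≡ leafSet t
      valid : Valid tree
      smaller : tree <T t
      removed : x List.∈ splits t
      keeps : ∀ {y} → y List.∈ splits t → y ≢ x → y List.∈ splits tree

  -- Predecessors of a child give predecessors of the vertex: the child is
  -- replaced by a smaller tree on the same leaves, so the vertex gets smaller
  -- and the split above the child is unchanged.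

  predecessor-right : ∀ (a₀ a₁ : BT {N}) {x} → Proper (node a₀ a₁) → Valid (node a₀ a₁) →
                      Predecessor a₁ x → Predecessor (node a₀ a₁) x
  predecessor-right a₀ (leaf _) _ _ (predecessor _ _ _ _ _ () _)
  predecessor-right a₀ (node _ _) _ _ (predecessor (leaf _) _ _ _ () _ _)
  predecessor-right a₀ a₁@(node _ _) {x} (p₀ , _ , a₀<a₁ , d) v
                    (predecessor r@(node _ _) pr ls vr r<a₁ x∈ keeps) =
    predecessor (node a₀ r)
      (p₀ , pr , subst (maxLeaf a₀ <_) (sym (maxLeaf-cong r a₁ ls)) a₀<a₁ ,
       (λ h₁ h₂ → d h₁ (subst (_ ∈_) ls h₂)))
      (cong (leafSet a₀ ∪_) ls) valid′ (inj₂ (ls , inj₁ r<a₁)) (splits-right⊆ a₀ a₁ x∈) keeps′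
    where
    valid′ : Valid (node a₀ r)
    valid′ m with ∈-++⁻ (belowSplits a₀) m
    ... | inj₁ m′ = v (∈-++⁺ˡ m′)
    ... | inj₂ (here refl) = subst Bicoloured (sym ls) (v (∈-++⁺ʳ (belowSplits a₀) (here refl)))
    ... | inj₂ (there m′) = vr m′
    keeps′ : ∀ {y} → y List.∈ splits (node a₀ a₁) → y ≢ x → y List.∈ splits (node a₀ r)
    keeps′ m y≢x with ∈-++⁻ (belowSplits a₀) m
    ... | inj₁ m′ = ∈-++⁺ˡ m′
    ... | inj₂ (here refl) = ∈-++⁺ʳ (belowSplits a₀) (here (sym ls))
    ... | inj₂ (there m′) = ∈-++⁺ʳ (belowSplits a₀) (there (keeps m′ y≢x))

  predecessor-left : ∀ (a₀ a₁ : BT {N}) {x} → Proper (node a₀ a₁) → Valid (node a₀ a₁) →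
                     Predecessor a₀ x → Predecessor (node a₀ a₁) x
  predecessor-left (leaf _) a₁ _ _ (predecessor _ _ _ _ _ () _)
  predecessor-left (node _ _) a₁ _ _ (predecessor (leaf _) _ _ _ () _ _)
  predecessor-left a₀@(node _ _) a₁ {x} (_ , p₁ , a₀<a₁ , d) v
                   (predecessor r@(node _ _) pr ls vr r<a₀ x∈ keeps) =
    predecessor (node r a₁)
      (pr , p₁ , subst (_< maxLeaf a₁) (sym (maxLeaf-cong r a₀ ls)) a₀<a₁ ,
       (λ h₁ h₂ → d (subst (_ ∈_) ls h₁) h₂))
      (cong (_∪ leafSet a₁) ls) valid′ (inj₂ (refl , inj₂ (refl , r<a₀))) (splits-left⊆ a₀ a₁ x∈) keeps′
    where
    valid′ : Valid (node r a₁)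
    valid′ m with ∈-++⁻ (belowSplits r) m
    ... | inj₁ (here refl) = subst Bicoloured (sym ls) (v (∈-++⁺ˡ {ys = belowSplits a₁} (here refl)))
    ... | inj₁ (there m′) = vr m′
    ... | inj₂ m′ = v (∈-++⁺ʳ (belowSplits a₀) m′)
    keeps′ : ∀ {y} → y List.∈ splits (node a₀ a₁) → y ≢ x → y List.∈ splits (node r a₁)
    keeps′ m y≢x with ∈-++⁻ (belowSplits a₀) m
    ... | inj₁ (here refl) = ∈-++⁺ˡ {ys = belowSplits a₁} (here (sym ls))
    ... | inj₁ (there m′) = ∈-++⁺ˡ (there (keeps m′ y≢x))
    ... | inj₂ m′ = ∈-++⁺ʳ (belowSplits r) m′

  rightMax-unmarked : ∀ (c₀ c₁ : BT {N}) → Proper (node c₀ c₁) → HasUnmarked n (leafSet (node c₀ c₁)) →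
                      Σ (Fin N) λ m₁ → m₁ ∈ leafSet c₁ × Unmarked m₁
  rightMax-unmarked c₀ c₁ pV (w , w∈V , n≤w) with maxLeaf-attained c₁
  ... | m₁ , m₁∈C₁ , m₁≡ =
    m₁ , m₁∈C₁ , ≤-trans n≤w (≤-trans (leaf≤maxLeaf (node c₀ c₁) w∈V)
                                      (≤-reflexive (trans (maxLeaf-right c₀ c₁ pV) (sym m₁≡))))

  -- Rotation of the edge above the right child V = C₀ ∪ C₁ of a vertex:
  -- s (c₀ c₁) becomes (s c₀) c₁, replacing the split V by S ∪ C₀.  The new
  -- split is bicoloured as soon as S ∪ C₀ has labels of both colours: outside
  -- it lie label 1 (marked) and the maximum of C₁ (unmarked).

  rotated-split-bicoloured : ∀ (s c₀ c₁ : BT {N}) → let p = node s (node c₀ c₁) in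
    Proper p → Valid p → OmitsRoot p →
    HasMarked n (leafSet s ∪ leafSet c₀) → HasUnmarked n (leafSet s ∪ leafSet c₀) →
    Bicoloured (leafSet s ∪ leafSet c₀)
  rotated-split-bicoloured s c₀ c₁ (_ , pV@(_ , _ , _ , dc) , _ , dp) v omits hm hu
    with rightMax-unmarked c₀ c₁ pV (unmarked-in (v (∈-++⁺ʳ (belowSplits s) (here refl))))
  ... | m₁ , m₁∈C₁ , m₁-unmarked =
    two≤card X (∈∪ˡ (maxLabel∈ s)) (∈∪ʳ (maxLabel∈ c₀))
      (λ e → dp (maxLabel∈ s) (subst (_∈ V) (sym e) (∈∪ˡ (maxLabel∈ c₀)))) ,
    proj₁ beyond , hm , hu , proj₂ beyond , (m₁ , x∉p⇒x∈∁p m₁∉X , m₁-unmarked)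
    where
    V X : Subset N
    V = leafSet (node c₀ c₁)
    X = leafSet s ∪ leafSet c₀
    X⊆p : X ⊆ leafSet (node s (node c₀ c₁))
    X⊆p h with x∈p∪q⁻ (leafSet s) (leafSet c₀) h
    ... | inj₁ h′ = ∈∪ˡ h′
    ... | inj₂ h′ = ∈∪ʳ (∈∪ˡ h′)
    m₁∉X : m₁ ∉ X
    m₁∉X h with x∈p∪q⁻ (leafSet s) (leafSet c₀) h
    ... | inj₁ h′ = dp h′ (∈∪ʳ m₁∈C₁)
    ... | inj₂ h′ = dc h′ m₁∈C₁
    beyond : 2 ≤ ∣ ∁ X ∣ × HasMarked n (∁ X)
    beyond = complement-of-leaves (node s (node c₀ c₁)) omits X⊆p (∈∪ʳ (∈∪ʳ m₁∈C₁)) m₁∉X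
               (marked-in (v (∈-++⁺ʳ (belowSplits s) (here refl))))

  rotate : ∀ (s c₀ c₁ : BT {N}) → let p = node s (node c₀ c₁) in
    Proper p → Valid p → OmitsRoot p →
    HasMarked n (leafSet s ∪ leafSet c₀) → HasUnmarked n (leafSet s ∪ leafSet c₀) →
    Predecessor p (leafSet (node c₀ c₁))
  rotate s c₀ c₁ pp@(ps , pV@(pc₀ , pc₁ , c₀<c₁ , dc) , s<V , dp) v omits hm hu =
    predecessor (node u c₁) (Join.proper J , pc₁ , u<c₁ , disjoint) leafSet≡ valid
      (inj₁ (right<S-node c₀ c₁ pV)) (∈-++⁺ʳ (belowSplits s) (here refl)) keeps
    where
    J : Join s c₀
    J = join s c₀ ps pc₀ (λ h₁ h₂ → dp h₁ (∈∪ˡ h₂))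
    u : BT {N}
    u = Join.tree J
    u<c₁ : maxLeaf u < maxLeaf c₁
    u<c₁ = subst (_< maxLeaf c₁) (sym (Join.maxLeaf≡ J))
             (⊔-lub (subst (maxLeaf s <_) (maxLeaf-right c₀ c₁ pV) s<V) c₀<c₁)
    disjoint : Disjoint (leafSet u) (leafSet c₁)
    disjoint {j} h₁ h₂ with x∈p∪q⁻ (leafSet s) (leafSet c₀) (subst (j ∈_) (Join.leafSet≡ J) h₁)
    ... | inj₁ h = dp h (∈∪ʳ h₂)
    ... | inj₂ h = dc h h₂
    leafSet≡ : leafSet u ∪ leafSet c₁ ≡ leafSet (node s (node c₀ c₁))
    leafSet≡ = trans (cong (_∪ leafSet c₁) (Join.leafSet≡ J)) (∪-assoc (leafSet s) (leafSet c₀) (leafSet c₁))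
    valid : Valid (node u c₁)
    valid m with ∈-++⁻ (belowSplits u) m
    ... | inj₂ m′ = v (splits-right⊆ s (node c₀ c₁) (∈-++⁺ʳ (belowSplits c₀) m′))
    ... | inj₁ m′ with belowSplits-cases u m′
    ...   | inj₁ refl = subst Bicoloured (sym (Join.leafSet≡ J)) (rotated-split-bicoloured s c₀ c₁ pp v omits hm hu)
    ...   | inj₂ m″ with ∈-++⁻ (belowSplits s) (Join.splits⁻ J m″)
    ...     | inj₁ m‴ = v (∈-++⁺ˡ m‴)
    ...     | inj₂ m‴ = v (splits-right⊆ s (node c₀ c₁) (∈-++⁺ˡ m‴))
    keeps : ∀ {y} → y List.∈ splits (node s (node c₀ c₁)) → y ≢ leafSet (node c₀ c₁) →
            y List.∈ splits (node u c₁)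
    keeps m y≢V with ∈-++⁻ (belowSplits s) m
    ... | inj₁ m′ = splits-left⊆ u c₁ (Join.splits⁺ J (∈-++⁺ˡ m′))
    ... | inj₂ (here refl) = ⊥-elim (y≢V refl)
    ... | inj₂ (there m′) with ∈-++⁻ (belowSplits c₀) m′
    ...   | inj₁ m″ = splits-left⊆ u c₁ (Join.splits⁺ J (∈-++⁺ʳ (belowSplits s) m″))
    ...   | inj₂ m″ = ∈-++⁺ʳ (belowSplits u) m″

  -- Exchange of two leaves of the same colour q < c in q (c c₁): the tree
  -- becomes c (q c₁), replacing the split {c} ∪ C₁ by {q} ∪ C₁.  The new
  -- split is bicoloured because q and c have the same colour and label 1
  -- (marked) stays outside.

  exchanged-split-bicoloured : ∀ (q c : Fin N) (c₁ : BT {N}) → let p = node (leaf q) (node (leaf c) c₁) in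
    Proper p → Valid p → OmitsRoot p → colour q ≡ colour c → Bicoloured (⁅ q ⁆ ∪ leafSet c₁)
  exchanged-split-bicoloured q c c₁ (_ , pV@(_ , _ , _ , dc) , _ , dp) v omits q~c =
    two≤card X (∈∪ˡ (x∈⁅x⁆ q)) (∈∪ʳ (maxLabel∈ c₁))
      (λ e → dp (x∈⁅x⁆ q) (∈∪ʳ (subst (_∈ C₁) (sym e) (maxLabel∈ c₁)))) ,
    proj₁ beyond , colours (colour-spec q)
    where
    C₁ X V : Subset N
    C₁ = leafSet c₁
    X = ⁅ q ⁆ ∪ C₁
    V = ⁅ c ⁆ ∪ C₁
    bV : Bicoloured V
    bV = v (here refl)
    c∉X : c ∉ X
    c∉X h with x∈p∪q⁻ ⁅ q ⁆ C₁ h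
    ... | inj₁ c∈q = dp (x∈⁅x⁆ q) (∈∪ˡ (subst (_∈ ⁅ c ⁆) (∈⁅⁆⇒≡ c∈q) (x∈⁅x⁆ c)))
    ... | inj₂ c∈C₁ = dc (x∈⁅x⁆ c) c∈C₁
    X⊆p : X ⊆ leafSet (node (leaf q) (node (leaf c) c₁))
    X⊆p h with x∈p∪q⁻ ⁅ q ⁆ C₁ h
    ... | inj₁ h′ = ∈∪ˡ h′
    ... | inj₂ h′ = ∈∪ʳ (∈∪ʳ h′)
    beyond : 2 ≤ ∣ ∁ X ∣ × HasMarked n (∁ X)
    beyond = complement-of-leaves (node (leaf q) (node (leaf c) c₁)) omits X⊆p
               (∈∪ʳ (∈∪ˡ (x∈⁅x⁆ c))) c∉X (marked-in bV)
    colours : (Marked q × colour q ≡ true) ⊎ (Unmarked q × colour q ≡ false) →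
              HasMarked n X × HasUnmarked n X × HasMarked n (∁ X) × HasUnmarked n (∁ X)
    colours (inj₁ (q-marked , _)) with rightMax-unmarked (leaf c) c₁ pV (unmarked-in bV) | unmarked-out bV
    ... | (m₁ , m₁∈C₁ , m₁-unmarked) | (w , w∉V , w-unmarked) =
      (q , ∈∪ˡ (x∈⁅x⁆ q) , q-marked) , (m₁ , ∈∪ʳ m₁∈C₁ , m₁-unmarked) , proj₂ beyond ,
      (w , x∉p⇒x∈∁p w∉X , w-unmarked)
      where
      w∉X : w ∉ X
      w∉X h with x∈p∪q⁻ ⁅ q ⁆ C₁ h
      ... | inj₁ w∈q = <⇒≱ q-marked (subst Unmarked (∈⁅⁆⇒≡ w∈q) w-unmarked)
      ... | inj₂ w∈C₁ = x∈∁p⇒x∉p w∉V (∈∪ʳ w∈C₁)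
    colours (inj₂ (q-unmarked , _)) with marked-in bV
    ... | (w , w∈V , w-marked) =
      (w , w∈X , w-marked) , (q , ∈∪ˡ (x∈⁅x⁆ q) , q-unmarked) , proj₂ beyond ,
      (c , x∉p⇒x∈∁p c∉X , c-unmarked)
      where
      c-unmarked : Unmarked c
      c-unmarked = sameColour-unmarked q~c q-unmarked
      w∈X : w ∈ X
      w∈X with x∈p∪q⁻ ⁅ c ⁆ C₁ w∈V
      ... | inj₁ w∈c = ⊥-elim (<⇒≱ w-marked (subst Unmarked (sym (∈⁅⁆⇒≡ w∈c)) c-unmarked))
      ... | inj₂ w∈C₁ = ∈∪ʳ w∈C₁

  exchange : ∀ (q c : Fin N) (c₁ : BT {N}) → let p = node (leaf q) (node (leaf c) c₁) in
    Proper p → Valid p → OmitsRoot p → toℕ q < toℕ c → colour q ≡ colour c →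
    Predecessor p (⁅ c ⁆ ∪ leafSet c₁)
  exchange q c c₁ pp@(_ , pV@(_ , pc₁ , c<c₁ , dc) , q<V , dp) v omits q<c q~c =
    predecessor (node (leaf c) (node (leaf q) c₁)) (tt , (tt , pc₁ , q<m₁ , q#C₁) , c<q⊔m₁ , c#X)
      leafSet≡ valid (inj₁ X<V) (here refl) keeps
    where
    C₁ X V : Subset N
    C₁ = leafSet c₁
    X = ⁅ q ⁆ ∪ C₁
    V = ⁅ c ⁆ ∪ C₁
    maxV≡ : toℕ c ⊔ maxLeaf c₁ ≡ maxLeaf c₁
    maxV≡ = maxLeaf-right (leaf c) c₁ pV
    q<m₁ : toℕ q < maxLeaf c₁
    q<m₁ = subst (toℕ q <_) maxV≡ q<V
    q#C₁ : Disjoint ⁅ q ⁆ C₁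
    q#C₁ h₁ h₂ = dp h₁ (∈∪ʳ h₂)
    c<q⊔m₁ : toℕ c < toℕ q ⊔ maxLeaf c₁
    c<q⊔m₁ = ≤-trans c<c₁ (m≤n⊔m (toℕ q) (maxLeaf c₁))
    c#X : Disjoint ⁅ c ⁆ X
    c#X {j} h₁ h₂ with x∈p∪q⁻ ⁅ q ⁆ C₁ h₂
    ... | inj₁ h = <-irrefl (cong toℕ (trans (sym (∈⁅⁆⇒≡ h)) (∈⁅⁆⇒≡ h₁))) q<c
    ... | inj₂ h = dc h₁ h
    leafSet≡ : ⁅ c ⁆ ∪ X ≡ ⁅ q ⁆ ∪ V
    leafSet≡ = trans (sym (∪-assoc ⁅ c ⁆ ⁅ q ⁆ C₁))
                 (trans (cong (_∪ C₁) (∪-comm ⁅ c ⁆ ⁅ q ⁆)) (∪-assoc ⁅ q ⁆ ⁅ c ⁆ C₁))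
    -- Above c the two splits agree: both consist of the labels of C₁ there.
    X<V : X <S V
    X<V = c , ∈∪ˡ (x∈⁅x⁆ c) , c#X (x∈⁅x⁆ c) , λ j c<j → X→V j c<j , V→X j c<j
      where
      X→V : ∀ j → toℕ c < toℕ j → j ∈ X → j ∈ V
      X→V j c<j h with x∈p∪q⁻ ⁅ q ⁆ C₁ h
      ... | inj₁ j∈q = ⊥-elim (<-irrefl (cong toℕ (sym (∈⁅⁆⇒≡ j∈q))) (<-trans q<c c<j))
      ... | inj₂ j∈C₁ = ∈∪ʳ j∈C₁
      V→X : ∀ j → toℕ c < toℕ j → j ∈ V → j ∈ X
      V→X j c<j h with x∈p∪q⁻ ⁅ c ⁆ C₁ h
      ... | inj₁ j∈c = ⊥-elim (<-irrefl (cong toℕ (sym (∈⁅⁆⇒≡ j∈c))) c<j)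
      ... | inj₂ j∈C₁ = ∈∪ʳ j∈C₁
    valid : Valid (node (leaf c) (node (leaf q) c₁))
    valid (here refl) = exchanged-split-bicoloured q c c₁ pp v omits q~c
    valid (there m) = v (there m)
    keeps : ∀ {y} → y List.∈ splits (node (leaf q) (node (leaf c) c₁)) → y ≢ V →
            y List.∈ splits (node (leaf c) (node (leaf q) c₁))
    keeps (here refl) y≢V = ⊥-elim (y≢V refl)
    keeps (there m) _ = there m

  -- A vertex s (c₀ c₁) is blocked when s and c₀ are leaves of equal colour
  -- with c₀ < s: then neither move applies.
  Blocked : BT {N} → BT {N} → Set
  Blocked s c₀ = Σ (Fin N) λ q → Σ (Fin N) λ c →
    s ≡ leaf q × c₀ ≡ leaf c × colour c ≡ colour q × toℕ c < toℕ q

  remove-between-leaves : ∀ (q c : Fin N) (c₁ : BT {N}) → let p = node (leaf q) (node (leaf c) c₁) in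
    Proper p → Valid p → OmitsRoot p → colour q ≡ colour c →
    Predecessor p (⁅ c ⁆ ∪ leafSet c₁) ⊎ Blocked (leaf q) (leaf c)
  remove-between-leaves q c c₁ pp@(_ , _ , _ , dp) v omits q~c with <-cmp (toℕ q) (toℕ c)
  ... | tri< q<c _ _ = inj₁ (exchange q c c₁ pp v omits q<c q~c)
  ... | tri> _ _ c<q = inj₂ (q , c , refl , refl , sym q~c , c<q)
  ... | tri≈ _ q≡c _ =
    ⊥-elim (dp (x∈⁅x⁆ q) (∈∪ˡ (subst (_∈ ⁅ c ⁆) (sym (toℕ-injective q≡c)) (x∈⁅x⁆ c))))

  -- If s or c₀ is not a leaf, its
  -- leaf set is a bicoloured split, so S ∪ C₀ has both colours and we rotate.
  remove-right-split : ∀ (s c₀ c₁ : BT {N}) → let p = node s (node c₀ c₁) in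
    Proper p → Valid p → OmitsRoot p → Predecessor p (leafSet (node c₀ c₁)) ⊎ Blocked s c₀
  remove-right-split s@(node _ _) c₀ c₁ pp v omits =
    inj₁ (rotate s c₀ c₁ pp v omits (witness-⊆ ∈∪ˡ (marked-in bS)) (witness-⊆ ∈∪ˡ (unmarked-in bS)))
    where
    bS : Bicoloured (leafSet s)
    bS = v (∈-++⁺ˡ {ys = belowSplits (node c₀ c₁)} (here refl))
  remove-right-split (leaf q) c₀@(node _ _) c₁ pp v omits =
    inj₁ (rotate (leaf q) c₀ c₁ pp v omits (witness-⊆ ∈∪ʳ (marked-in bC₀)) (witness-⊆ ∈∪ʳ (unmarked-in bC₀)))
    where
    bC₀ : Bicoloured (leafSet c₀)
    bC₀ = v (splits-right⊆ (leaf q) (node c₀ c₁) (∈-++⁺ˡ {ys = belowSplits c₁} (here refl)))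
  remove-right-split (leaf q) (leaf c) c₁ pp v omits with colour-spec q | colour-spec c
  ... | inj₁ (q-marked , _) | inj₂ (c-unmarked , _) =
    inj₁ (rotate (leaf q) (leaf c) c₁ pp v omits
            (q , ∈∪ˡ (x∈⁅x⁆ q) , q-marked) (c , ∈∪ʳ (x∈⁅x⁆ c) , c-unmarked))
  ... | inj₂ (q-unmarked , _) | inj₁ (c-marked , _) =
    inj₁ (rotate (leaf q) (leaf c) c₁ pp v omits
            (c , ∈∪ʳ (x∈⁅x⁆ c) , c-marked) (q , ∈∪ˡ (x∈⁅x⁆ q) , q-unmarked))
  ... | inj₁ (_ , q-true) | inj₁ (_ , c-true) =
    remove-between-leaves q c c₁ pp v omits (trans q-true (sym c-true))
  ... | inj₂ (_ , q-false) | inj₂ (_ , c-false) =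
    remove-between-leaves q c c₁ pp v omits (trans q-false (sym c-false))

  -- The left child of a valid proper tree cannot consist of at least two
  -- labels of one colour: either it is a single leaf, or its leaf set is a
  -- split of the tree and hence bicoloured.
  leftChild-not-monochromatic : ∀ (b₀ b₁ : BT {N}) → Valid (node b₀ b₁) → ∀ {i j} →
    i ∈ leafSet b₀ → j ∈ leafSet b₀ → i ≢ j →
    (col : Bool) → (∀ {l} → l ∈ leafSet b₀ → colour l ≡ col) → ⊥
  leftChild-not-monochromatic (leaf z) b₁ v i∈ j∈ i≢j col mono = i≢j (trans (∈⁅⁆⇒≡ i∈) (sym (∈⁅⁆⇒≡ j∈)))
  leftChild-not-monochromatic b₀@(node _ _) b₁ v _ _ _ col mono =
    let bB₀ = v (∈-++⁺ˡ {ys = belowSplits b₁} (here refl))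
        (w₁ , w₁∈ , w₁-marked) = marked-in bB₀ ; (w₂ , w₂∈ , w₂-unmarked) = unmarked-in bB₀
    in colour-separates w₁-marked w₂-unmarked (trans (mono w₁∈) (sym (mono w₂∈)))

  ShellingStep : BT {N} → BT {N} → Set
  ShellingStep t t′ = Σ (Subset N) λ x → Predecessor t x × (x List.∈ splits t′ → ⊥)

  -- C′ = b₀ b₁ is valid and proper on the leaf set L, and
  -- C has right child A₁ with left sibling the leaf q₁, where B₁ <S A₁ is
  -- witnessed by k ∈ A₁ ∖ B₁ (above k, B₁ ⊆ A₁).  Walking down the right
  -- spine of A₁ we keep the invariant that all labels of L outside the
  -- current subtree have the colour of q₁ and are at most q₁.
  module BlockedSpine (b₀ b₁ : BT {N}) (p′ : Proper (node b₀ b₁)) (v′ : Valid (node b₀ b₁))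
                      (A₁ : Subset N) (q₁ k : Fin N)
                      (k∈L : k ∈ leafSet (node b₀ b₁)) (q₁∈L : q₁ ∈ leafSet (node b₀ b₁))
                      (k∈A₁ : k ∈ A₁) (k∉B₁ : k ∉ leafSet b₁) (q₁∉A₁ : q₁ ∉ A₁)
                      (agree : ∀ j → toℕ k < toℕ j → j ∈ leafSet b₁ → j ∈ A₁) where

    Confined : Subset N → Set
    Confined V = ∀ {j} → j ∈ leafSet (node b₀ b₁) → j ∉ V → colour j ≡ colour q₁ × toℕ j ≤ toℕ q₁

    -- The invariant fails for every set of labels inside B₁: then k and q₁
    -- would be two labels of the colour of q₁ in B₀.
    confined-not-right : ∀ (V : Subset N) → V ⊆ leafSet b₁ → Confined V → ⊥
    confined-not-right V V⊆B₁ confined =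
      leftChild-not-monochromatic b₀ b₁ v′ (inB₀ k∈L k∉B₁) (inB₀ q₁∈L q₁∉B₁)
        (λ e → <-irrefl (cong toℕ e) k<q₁) (colour q₁) (λ l∈ → proj₁ (confinedB₀ l∈))
      where
      d′ : Disjoint (leafSet b₀) (leafSet b₁)
      d′ = proj₂ (proj₂ (proj₂ p′))
      confinedB₀ : ∀ {j} → j ∈ leafSet b₀ → colour j ≡ colour q₁ × toℕ j ≤ toℕ q₁
      confinedB₀ j∈B₀ = confined (∈∪ˡ j∈B₀) (λ j∈V → d′ j∈B₀ (V⊆B₁ j∈V))
      inB₀ : ∀ {j} → j ∈ leafSet (node b₀ b₁) → j ∉ leafSet b₁ → j ∈ leafSet b₀
      inB₀ {j} j∈L j∉B₁ with x∈p∪q⁻ (leafSet b₀) (leafSet b₁) j∈L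
      ... | inj₁ h = h
      ... | inj₂ h = ⊥-elim (j∉B₁ h)
      k<q₁ : toℕ k < toℕ q₁
      k<q₁ = ≤∧≢⇒< (proj₂ (confined k∈L (λ k∈V → k∉B₁ (V⊆B₁ k∈V))))
                    (λ e → q₁∉A₁ (subst (_∈ A₁) (toℕ-injective e) k∈A₁))
      q₁∉B₁ : q₁ ∉ leafSet b₁
      q₁∉B₁ h = q₁∉A₁ (agree q₁ k<q₁ h)

    -- Descending along the spine c (…(e e₁)…): at each vertex either a move
    -- removes the split above the right child, which contains the maximal
    -- label and so could only be a split of C′ inside B₁; or the vertex is
    -- blocked by a smaller leaf e of the same colour and we descend.
    descend : ∀ (c : Fin N) (v : BT {N}) → let t = node (leaf c) v in
      Proper t → Valid t → OmitsRoot t → maxLeaf v ≡ maxLeaf (node b₀ b₁) →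
      colour c ≡ colour q₁ → toℕ c ≤ toℕ q₁ → Confined (leafSet v) → ShellingStep t (node b₀ b₁)
    descend c (leaf m) _ _ _ m-max _ _ confined =
      ⊥-elim (confined-not-right ⁅ m ⁆
        (λ h → subst (_∈ leafSet b₁) (sym (∈⁅⁆⇒≡ h)) (maxLabel∈right b₀ b₁ p′ m-max)) confined)
    descend c v@(node e₀ e₁) pt@(_ , pv , _ , _) vt omits v-max c~q₁ c≤q₁ confined
      with remove-right-split (leaf c) e₀ e₁ pt vt omits
    ... | inj₁ pred =
      leafSet v , pred ,
      λ m → confined-not-right (leafSet v)
              (split∋max⊆right b₀ b₁ p′ m (maxLabel∈ v) (trans (maxLabel-toℕ v) v-max)) confined
    ... | inj₂ (_ , e , refl , refl , e~c , e<c) =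
      let (x , pred , x∉) = descend e e₁ pv (valid-right (leaf c) v vt) (λ h → omits (∈∪ʳ h))
                               (trans (sym (maxLeaf-right (leaf e) e₁ pv)) v-max)
                               (trans e~c c~q₁) (≤-trans (<⇒≤ e<c) c≤q₁) confined′
      in x , predecessor-right (leaf c) v pt vt pred , x∉
      where
      confined′ : Confined (leafSet e₁)
      confined′ {j} j∈L j∉E₁ with j ≟ᶠ e
      ... | yes refl = trans e~c c~q₁ , ≤-trans (<⇒≤ e<c) c≤q₁
      ... | no j≢e =
        confined j∈L λ h → [ (λ j∈e → j≢e (∈⁅⁆⇒≡ j∈e)) , j∉E₁ ]′ (x∈p∪q⁻ ⁅ e ⁆ (leafSet e₁) h)

  -- The case B₁ <S A₁ of the construction for C = a₀ a₁ and C′ = b₀ b₁: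
  -- remove the split A₁ by a move (it contains the maximal label but also
  -- k ∉ B₁, so it is not a split of C′), or, if blocked, descend the right
  -- spine of A₁.  A₁ is not a single leaf, since it would be the maximum.
  shell-rightSplit : ∀ (a₀ a₁ b₀ b₁ : BT {N}) → let p = node a₀ a₁ ; p′ = node b₀ b₁ in
    Proper p → Proper p′ → Valid p → Valid p′ → OmitsRoot p →
    leafSet p′ ≡ leafSet p → leafSet b₁ <S leafSet a₁ → ShellingStep p p′
  shell-rightSplit a₀ (leaf m) b₀ b₁ pp pp′ _ _ _ eL (k , k∈m , k∉B₁ , _) =
    ⊥-elim (k∉B₁ (maxLabel∈right b₀ b₁ pp′ k-max))
    where
    k-max : toℕ k ≡ maxLeaf (node b₀ b₁)
    k-max = trans (cong toℕ (∈⁅⁆⇒≡ k∈m))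
              (trans (sym (maxLeaf-right a₀ (leaf m) pp)) (maxLeaf-cong (node a₀ (leaf m)) (node b₀ b₁) (sym eL)))
  shell-rightSplit a₀ a₁@(node c₀ c₁) b₀ b₁ pp@(_ , pa₁ , _ , dp) pp′ v v′ omits eL (k , k∈A₁ , k∉B₁ , agree)
    with remove-right-split a₀ c₀ c₁ pp v omits
  ... | inj₁ pred = leafSet a₁ , pred , λ m → k∉B₁ (split∋max⊆right b₀ b₁ pp′ m (maxLabel∈ a₁) a₁-max k∈A₁)
    where
    a₁-max : toℕ (maxLabel a₁) ≡ maxLeaf (node b₀ b₁)
    a₁-max = trans (maxLabel-toℕ a₁)
               (trans (sym (maxLeaf-right a₀ a₁ pp)) (maxLeaf-cong (node a₀ a₁) (node b₀ b₁) (sym eL)))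
  ... | inj₂ (q₁ , c , refl , refl , c~q₁ , c<q₁) =
    let (x , pred , x∉) = descend c c₁ pa₁ (valid-right (leaf q₁) a₁ v) (λ h → omits (∈∪ʳ h))
                            c₁-max c~q₁ (<⇒≤ c<q₁) confined
    in x , predecessor-right (leaf q₁) a₁ pp v pred , x∉
    where
    open BlockedSpine b₀ b₁ pp′ v′ (leafSet a₁) q₁ k
           (subst (k ∈_) (sym eL) (∈∪ʳ k∈A₁)) (subst (q₁ ∈_) (sym eL) (∈∪ˡ (x∈⁅x⁆ q₁)))
           k∈A₁ k∉B₁ (dp (x∈⁅x⁆ q₁)) (λ j k<j → proj₁ (agree j k<j))
    c₁-max : maxLeaf c₁ ≡ maxLeaf (node b₀ b₁)
    c₁-max = trans (sym (maxLeaf-right (leaf c) c₁ pa₁))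
               (trans (sym (maxLeaf-right (leaf q₁) a₁ pp)) (maxLeaf-cong (node (leaf q₁) a₁) (node b₀ b₁) (sym eL)))
    -- Outside C₁ there are only the leaves q₁ and c.
    confined : Confined (leafSet c₁)
    confined {j} j∈L j∉C₁ with x∈p∪q⁻ ⁅ q₁ ⁆ (leafSet a₁) (subst (j ∈_) eL j∈L)
    ... | inj₁ j∈q₁ rewrite ∈⁅⁆⇒≡ j∈q₁ = refl , ≤-refl
    ... | inj₂ j∈A₁ with x∈p∪q⁻ ⁅ c ⁆ (leafSet c₁) j∈A₁
    ...   | inj₁ j∈c rewrite ∈⁅⁆⇒≡ j∈c = c~q₁ , <⇒≤ c<q₁
    ...   | inj₂ j∈C₁ = ⊥-elim (j∉C₁ j∈C₁)

  shell : ∀ (p p′ : BT {N}) → Proper p → Proper p′ → Valid p → Valid p′ → OmitsRoot p →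
          leafSet p′ ≡ leafSet p → p′ <T p → ShellingStep p p′
  shell (leaf _) (leaf _) _ _ _ _ _ _ ()
  shell (leaf _) (node _ _) _ _ _ _ _ _ ()
  shell (node _ _) (leaf _) _ _ _ _ _ _ ()
  shell (node a₀ a₁) (node b₀ b₁) pp pp′ v v′ omits eL (inj₁ B₁<A₁) =
    shell-rightSplit a₀ a₁ b₀ b₁ pp pp′ v v′ omits eL B₁<A₁
  shell (node a₀ a₁) (node b₀ b₁) pp@(_ , pa₁ , _ , _) (_ , pb₁ , _ , db) v v′ omits _
        (inj₂ (e₁ , inj₁ b₁<a₁)) =
    let (x , pred , x∉) = shell a₁ b₁ pa₁ pb₁ (valid-right a₀ a₁ v) (valid-right b₀ b₁ v′)
                            (λ h → omits (∈∪ʳ h)) e₁ b₁<a₁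
    in x , predecessor-right a₀ a₁ pp v pred ,
       λ m → x∉ (split-of-right-child a₁ b₀ b₁ pa₁ db e₁ (Predecessor.removed pred) m)
  shell (node a₀ a₁) (node b₀ .a₁) pp@(pa₀ , _ , _ , da) (pb₀ , _ , _ , db) v v′ omits eL
        (inj₂ (e₁ , inj₂ (refl , b₀<a₀))) =
    let e₀ = disjoint-∪-cancelʳ db da eL e₁
        (x , pred , x∉) = shell a₀ b₀ pa₀ pb₀ (valid-left a₀ a₁ v) (valid-left b₀ a₁ v′)
                            (λ h → omits (∈∪ˡ h)) e₀ b₀<a₀
    in x , predecessor-left a₀ a₁ pp v pred ,
       λ m → x∉ (split-of-left-child a₀ b₀ a₁ pa₀ da e₀ (Predecessor.removed pred) m)

  facet⇒proper : ∀ (C : BT {N}) → IsFacet n C → Proper C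
  facet⇒proper C (canonical , (unique , _) , _) = canonical⇒proper C canonical unique

  facet⇒valid : ∀ (C : BT {N}) → IsFacet n C → Valid C
  facet⇒valid C (_ , _ , bicoloured) m = All.lookup bicoloured m

  facet⇒omitsRoot : ∀ (C : BT {N}) → IsFacet n C → OmitsRoot C
  facet⇒omitsRoot C (_ , (_ , labels) , _) {j} h = proj₁ (labels j) (∈leafSet⇒∈leaves C h)

  facet-contains : ∀ (C : BT {N}) → IsFacet n C → ∀ {j} → toℕ j ≢ 0 → j ∈ leafSet C
  facet-contains C (_ , (_ , labels) , _) {j} j≢0 = ∈leaves⇒∈leafSet C (proj₂ (labels j) j≢0)

  facets-sameLeaves : ∀ (C C′ : BT {N}) → IsFacet n C → IsFacet n C′ → leafSet C ≡ leafSet C′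
  facets-sameLeaves C C′ fC fC′ =
    ⊆-antisym (λ h → facet-contains C′ fC′ (facet⇒omitsRoot C fC h))
              (λ h → facet-contains C fC (facet⇒omitsRoot C′ fC′ h))

  facet-onLeaves : ∀ (C t : BT {N}) → IsFacet n C → Proper t → Valid t → leafSet t ≡ leafSet C → IsFacet n t
  facet-onLeaves C t fC pt vt e =
    proper⇒canonical t pt , (proper⇒unique t pt , labels) , All.tabulate vt
    where
    labels : (j : Fin N) → (j List.∈ leaves t → toℕ j ≢ 0) × (toℕ j ≢ 0 → j List.∈ leaves t)
    labels j = (λ h → facet⇒omitsRoot C fC (subst (j ∈_) e (∈leaves⇒∈leafSet t h))) ,
               (λ j≢0 → ∈leafSet⇒∈leaves t (subst (j ∈_) (sym e) (facet-contains C fC j≢0)))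

  facetOrder-strictTotal : IsStrictTotalOn {N} (IsFacet n) _<T_
  facetOrder-strictTotal =
    (λ C _ → <T-irrefl C) ,
    (λ C₁ C₂ C₃ _ _ _ → <T-trans C₁ C₂ C₃) ,
    (λ C₁ C₂ f₁ f₂ → <T-tri C₁ C₂ (facet⇒proper C₁ f₁) (facet⇒proper C₂ f₂)
                            (facets-sameLeaves C₁ C₂ f₁ f₂))

  facetOrder-shelling : IsShellingOrder {N} (IsFacet n) _<T_
  facetOrder-shelling C C′ fC fC′ C′<C =
    let (x , predecessor C″ pC″ eC″ vC″ C″<C x∈C keeps , x∉C′) =
          shell C C′ (facet⇒proper C fC) (facet⇒proper C′ fC′) (facet⇒valid C fC) (facet⇒valid C′ fC′)
                (facet⇒omitsRoot C fC) (facets-sameLeaves C′ C fC′ fC) C′<C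
    in C″ , facet-onLeaves C C″ fC pC″ vC″ eC″ , C″<C , x , x∈C , x∉C′ , λ y → keeps {y}

theorem3p2 : (n d : ℕ) →
    IsStrictTotalOn {n + d} (IsFacet n) _<T_ × IsShellingOrder {n + d} (IsFacet n) _<T_
theorem3p2 n d = Shelling.facetOrder-strictTotal n , Shelling.facetOrder-shelling n
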